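{- For any algebra $\mathbf A$, the following are equivalent: (i) For all $\theta\in\mathrm{KCon}\,\mathbf A$, the compact lifting of the quotient map $p_\theta\colon\mathbf A\twoheadrightarrow\mathbf A/\theta$ has a left adjoint. (ii) The join-semilattice $\mathrm{KCon}\,\mathbf A$ is dually Brouwerian.
   Context: $\mathrm{KCon}\,\mathbf A$ is the join-semilattice of compact (finitely generated) congruences of the algebra $\mathbf A$, ordered by inclusion. A join-semilattice $L$ is dually Brouwerian if for all $a,b\in L$ there is $a-b\in L$ with $a-b\le c\iff a\le b\vee c$ for all $c\in L$. For a homomorphism $h\colon\mathbf A\to\mathbf B$, the compact lifting of $h$ is the map $\mathrm{KCon}\,\mathbf A\to\mathrm{KCon}\,\mathbf B$ sending $\psi$ to the congruence generated by $\{(h(a),h(a')):(a,a')\in\psi\}$. A map $f\colon P\to Q$ of posets has a left adjoint $g$ if $g(b)\le a\iff b\le f(a)$ for all $a\in P$, $b\in Q$. -}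

module Defs where

open import Level using (Level; suc; _⊔_)
open import Data.Nat using (ℕ)
open import Data.Fin using (Fin)
open import Data.Product using (Σ; Σ-syntax; _×_; _,_; proj₁; proj₂)
open import Data.Sum using (_⊎_; inj₁; inj₂)
open import Data.List using (List; _++_; map)
open import Data.List.Membership.Propositional using (_∈_)
open import Data.List.Membership.Propositional.Properties using (∈-++⁺ˡ; ∈-++⁺ʳ; ∈-++⁻; ∈-map⁺; ∈-map⁻)
open import Relation.Binary using (Rel; IsEquivalence)
open import Relation.Binary.PropositionalEquality using (_≡_; refl)

record Signature (ℓ : Level) : Set (suc ℓ) where
  field
    Op    : Set ℓ
    arity : Op → ℕ

module _ {ℓ : Level} (Sg : Signature ℓ) where
  open Signature Sg

  record Algebra : Set (suc ℓ) where
    field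
      Carrier : Set ℓ
      _≈_     : Rel Carrier ℓ
      isEquivalence : IsEquivalence _≈_
      ⟦_⟧     : (f : Op) → (Fin (arity f) → Carrier) → Carrier
      ⟦⟧-cong : ∀ f (xs ys : Fin (arity f) → Carrier) →
                (∀ i → xs i ≈ ys i) → ⟦ f ⟧ xs ≈ ⟦ f ⟧ ys

  record Homomorphism (A B : Algebra) : Set ℓ where
    private
      module A = Algebra A
      module B = Algebra B
    field
      fun      : A.Carrier → B.Carrier
      fun-cong : ∀ {x y} → x A.≈ y → fun x B.≈ fun y
      preserve : ∀ f (xs : Fin (arity f) → A.Carrier) →
                 fun (A.⟦ f ⟧ xs) B.≈ B.⟦ f ⟧ (λ i → fun (xs i))

  module _ (A : Algebra) where
    open Algebra A

    data Cg (R : Rel Carrier ℓ) : Rel Carrier ℓ where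
      inc    : ∀ {x y} → R x y → Cg R x y
      ≈-inc  : ∀ {x y} → x ≈ y → Cg R x y
      sym    : ∀ {x y} → Cg R x y → Cg R y x
      trans  : ∀ {x y z} → Cg R x y → Cg R y z → Cg R x z
      compat : ∀ f (xs ys : Fin (arity f) → Carrier) →
               (∀ i → Cg R (xs i) (ys i)) → Cg R (⟦ f ⟧ xs) (⟦ f ⟧ ys)

    InList : List (Carrier × Carrier) → Rel Carrier ℓ
    InList X x y = (x , y) ∈ X

    -- Compact (finitely generated) congruences of A: a relation θ
    -- together with a finite set of generators X with θ = Cg X.
    record KCon : Set (suc ℓ) where
      field
        rel  : Rel Carrier ℓ
        gens : List (Carrier × Carrier)
        gen→ : ∀ {x y} → rel x y → Cg (InList gens) x y
        gen← : ∀ {x y} → Cg (InList gens) x y → rel x y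

    open KCon public

    _⊑_ : KCon → KCon → Set ℓ
    θ ⊑ φ = ∀ {x y} → rel θ x y → rel φ x y

    Cg-mono : ∀ {R S : Rel Carrier ℓ} →
              (∀ {x y} → R x y → Cg S x y) → ∀ {x y} → Cg R x y → Cg S x y
    Cg-mono h (inc r) = h r
    Cg-mono h (≈-inc e) = ≈-inc e
    Cg-mono h (sym p) = sym (Cg-mono h p)
    Cg-mono h (trans p q) = trans (Cg-mono h p) (Cg-mono h q)
    Cg-mono h (compat f xs ys ps) = compat f xs ys (λ i → Cg-mono h (ps i))

    _⊔K_ : KCon → KCon → KCon
    θ ⊔K φ = record
      { rel  = Cg (λ x y → rel θ x y ⊎ rel φ x y)
      ; gens = gens θ ++ gens φ
      ; gen→ = Cg-mono to
      ; gen← = Cg-mono from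
      }
      where
      to : ∀ {x y} → (rel θ x y ⊎ rel φ x y) → Cg (InList (gens θ ++ gens φ)) x y
      to (inj₁ r) = Cg-mono (λ m → inc (∈-++⁺ˡ m)) (gen→ θ r)
      to (inj₂ r) = Cg-mono (λ m → inc (∈-++⁺ʳ (gens θ) m)) (gen→ φ r)
      from : ∀ {x y} → InList (gens θ ++ gens φ) x y → Cg (λ x y → rel θ x y ⊎ rel φ x y) x y
      from m with ∈-++⁻ (gens θ) m
      ... | inj₁ m₁ = inc (inj₁ (gen← θ (inc m₁)))
      ... | inj₂ m₂ = inc (inj₂ (gen← φ (inc m₂)))

  module _ {A B : Algebra} (h : Homomorphism A B) where
    private
      module A = Algebra A
      module B = Algebra B
      open Homomorphism h

    ImageRel : KCon A → Rel B.Carrier ℓ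
    ImageRel ψ x y = Σ[ a ∈ A.Carrier ] Σ[ a' ∈ A.Carrier ]
                       (rel ψ a a' × x ≡ fun a × y ≡ fun a')

    private
      hpair : A.Carrier × A.Carrier → B.Carrier × B.Carrier
      hpair (a , a') = (fun a , fun a')

      push : ∀ (X : List (A.Carrier × A.Carrier)) {a a'} →
             Cg A (InList A X) a a' → Cg B (InList B (map hpair X)) (fun a) (fun a')
      push X (inc m) = inc (∈-map⁺ hpair m)
      push X (≈-inc e) = ≈-inc (fun-cong e)
      push X (sym p) = sym (push X p)
      push X (trans p q) = trans (push X p) (push X q)
      push X (compat f xs ys ps) =
        trans (≈-inc (preserve f xs))
          (trans (compat f _ _ (λ i → push X (ps i)))
                 (sym (≈-inc (preserve f ys))))

    compactLifting : KCon A → KCon B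
    compactLifting ψ = record
      { rel  = Cg B (ImageRel ψ)
      ; gens = map hpair (gens ψ)
      ; gen→ = Cg-mono B to
      ; gen← = Cg-mono B from
      }
      where
      to : ∀ {x y} → ImageRel ψ x y → Cg B (InList B (map hpair (gens ψ))) x y
      to (a , a' , r , refl , refl) = push (gens ψ) (gen→ ψ r)
      from : ∀ {x y} → InList B (map hpair (gens ψ)) x y → Cg B (ImageRel ψ) x y
      from m with ∈-map⁻ hpair m
      ... | (a , a') , m' , refl = inc (a , a' , gen← ψ (inc m') , refl , refl)

  module _ (A : Algebra) (θ : KCon A) where
    private module A = Algebra A

    _/_ : Algebra
    _/_ = record
      { Carrier = A.Carrier
      ; _≈_ = rel θ
      ; isEquivalence = record
          { refl  = gen← θ (≈-inc (IsEquivalence.refl A.isEquivalence))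
          ; sym   = λ p → gen← θ (sym (gen→ θ p))
          ; trans = λ p q → gen← θ (trans (gen→ θ p) (gen→ θ q))
          }
      ; ⟦_⟧ = A.⟦_⟧
      ; ⟦⟧-cong = λ f xs ys ps → gen← θ (compat f xs ys (λ i → gen→ θ (ps i)))
      }

    quotientMap : Homomorphism A _/_
    quotientMap = record
      { fun = λ x → x
      ; fun-cong = λ e → gen← θ (≈-inc e)
      ; preserve = λ f xs → gen← θ (≈-inc (IsEquivalence.refl A.isEquivalence))
      }

HasLeftAdjoint : ∀ {p q r s} {P : Set p} {Q : Set q} →
                 (P → P → Set r) → (Q → Q → Set s) → (P → Q) → Set (p ⊔ q ⊔ r ⊔ s)
HasLeftAdjoint {P = P} {Q} _≤P_ _≤Q_ f =
  Σ[ g ∈ (Q → P) ] (∀ a b → ((g b ≤P a → b ≤Q f a) × (b ≤Q f a → g b ≤P a)))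

DuallyBrouwerian : ∀ {l r} {L : Set l} → (L → L → Set r) → (L → L → L) → Set (l ⊔ r)
DuallyBrouwerian {L = L} _≤_ _∨_ =
  ∀ a b → Σ[ d ∈ L ] (∀ c → ((d ≤ c → a ≤ (b ∨ c)) × (a ≤ (b ∨ c) → d ≤ c)))

-- Up to equality of relations, KCon (A/θ) is the principal filter of θ in
-- KCon A: forgetting the quotient embeds it into KCon A, and the compact
-- lifting of the quotient map is ψ ↦ θ ∨ ψ, left adjoint to that embedding.
-- Hence a left adjoint to the lifting at θ sends β to β − θ, and conversely
-- a − b is the adjoint at b applied to the lift of a.
module Submission where

open import Defs
open import Level using (Level)
open import Data.Product using (_×_; _,_; proj₁; proj₂)
open import Data.Sum using (inj₁; inj₂)
open import Data.List using (_++_)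
open import Data.List.Membership.Propositional.Properties using (∈-++⁺ˡ; ∈-++⁺ʳ; ∈-++⁻)
open import Function.Bundles using (_⇔_; mk⇔; Equivalence)
open import Function.Properties.Equivalence using (⇔-setoid)
open import Relation.Binary using (Rel; _⇒_)
open import Relation.Binary.Construct.Union using (_∪_)
open import Relation.Binary.PropositionalEquality using (refl)
import Relation.Binary.Reasoning.Setoid as SetoidReasoning

Cg-closed : ∀ {ℓ} {Sg : Signature ℓ} (A : Algebra Sg) (ψ : KCon Sg A) → Cg Sg A (rel ψ) ⇒ rel ψ
Cg-closed {Sg = Sg} A ψ p = gen← ψ (Cg-mono Sg A (gen→ ψ) p)

module _ {ℓ : Level} {Sg : Signature ℓ} (A : Algebra Sg) where
  open Algebra A using (Carrier)

  private
    infix 4 _≤_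
    infixr 6 _∨_
    _≤_ : KCon Sg A → KCon Sg A → Set ℓ
    _≤_ = _⊑_ Sg A
    _∨_ : KCon Sg A → KCon Sg A → KCon Sg A
    _∨_ = _⊔K_ Sg A

  module Quotient (θ : KCon Sg A) where

    A/θ : Algebra Sg
    A/θ = _/_ Sg A θ

    lift : KCon Sg A → KCon Sg A/θ
    lift = compactLifting Sg (quotientMap Sg A θ)

    infix 4 _≤/_
    _≤/_ : KCon Sg A/θ → KCon Sg A/θ → Set ℓ
    _≤/_ = _⊑_ Sg A/θ

    Cg-quotient⇒Cg-∪ : {R : Rel Carrier ℓ} → Cg Sg A/θ R ⇒ Cg Sg A (R ∪ rel θ)
    Cg-quotient⇒Cg-∪ (inc r)             = inc (inj₁ r)
    Cg-quotient⇒Cg-∪ (≈-inc e)           = inc (inj₂ e)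
    Cg-quotient⇒Cg-∪ (sym p)             = sym (Cg-quotient⇒Cg-∪ p)
    Cg-quotient⇒Cg-∪ (trans p q)         = trans (Cg-quotient⇒Cg-∪ p) (Cg-quotient⇒Cg-∪ q)
    Cg-quotient⇒Cg-∪ (compat f xs ys ps) = compat f xs ys (λ i → Cg-quotient⇒Cg-∪ (ps i))

    Cg-∪⇒Cg-quotient : {R : Rel Carrier ℓ} → Cg Sg A (R ∪ rel θ) ⇒ Cg Sg A/θ R
    Cg-∪⇒Cg-quotient (inc (inj₁ r))      = inc r
    Cg-∪⇒Cg-quotient (inc (inj₂ e))      = ≈-inc e
    Cg-∪⇒Cg-quotient (≈-inc e)           = ≈-inc (gen← θ (≈-inc e))
    Cg-∪⇒Cg-quotient (sym p)             = sym (Cg-∪⇒Cg-quotient p)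
    Cg-∪⇒Cg-quotient (trans p q)         = trans (Cg-∪⇒Cg-quotient p) (Cg-∪⇒Cg-quotient q)
    Cg-∪⇒Cg-quotient (compat f xs ys ps) = compat f xs ys (λ i → Cg-∪⇒Cg-quotient (ps i))

    forget : KCon Sg A/θ → KCon Sg A
    forget β = record
      { rel  = rel β
      ; gens = gens β ++ gens θ
      ; gen→ = λ r → Cg-mono Sg A generate (Cg-quotient⇒Cg-∪ (gen→ β r))
      ; gen← = λ p → gen← β (Cg-∪⇒Cg-quotient (Cg-mono Sg A split p))
      }
      where
      generate : InList Sg A/θ (gens β) ∪ rel θ ⇒ Cg Sg A (InList Sg A (gens β ++ gens θ))
      generate (inj₁ m) = inc (∈-++⁺ˡ m)
      generate (inj₂ e) = Cg-mono Sg A (λ m → inc (∈-++⁺ʳ (gens β) m)) (gen→ θ e)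

      split : InList Sg A (gens β ++ gens θ) ⇒ Cg Sg A (InList Sg A/θ (gens β) ∪ rel θ)
      split m with ∈-++⁻ (gens β) m
      ... | inj₁ m₁ = inc (inj₁ m₁)
      ... | inj₂ m₂ = inc (inj₂ (gen← θ (inc m₂)))

    lift⊣forget : (ψ : KCon Sg A) (β : KCon Sg A/θ) → lift ψ ≤/ β ⇔ ψ ≤ forget β
    lift⊣forget ψ β = mk⇔
      (λ lψ≤β {_} {_} r → lψ≤β (inc (_ , _ , r , refl , refl)))
      (λ ψ≤β {_} {_} p →
        Cg-closed A/θ β (Cg-mono Sg A/θ (λ { (_ , _ , r , refl , refl) → inc (ψ≤β r) }) p))

    lift⇒∨ : (φ : KCon Sg A) → rel (lift φ) ⇒ rel (θ ∨ φ)
    lift⇒∨ φ p = Cg-mono Sg A swap (Cg-quotient⇒Cg-∪ p)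
      where
      swap : ImageRel Sg (quotientMap Sg A θ) φ ∪ rel θ ⇒ Cg Sg A (rel θ ∪ rel φ)
      swap (inj₁ (_ , _ , r , refl , refl)) = inc (inj₂ r)
      swap (inj₂ e)                         = inc (inj₁ e)

    ∨⇒lift : (φ : KCon Sg A) → rel (θ ∨ φ) ⇒ rel (lift φ)
    ∨⇒lift φ p = Cg-∪⇒Cg-quotient (Cg-mono Sg A swap p)
      where
      swap : rel θ ∪ rel φ ⇒ Cg Sg A (ImageRel Sg (quotientMap Sg A θ) φ ∪ rel θ)
      swap (inj₁ e) = inc (inj₂ e)
      swap (inj₂ r) = inc (inj₁ (_ , _ , r , refl , refl))

    ≤-forget-lift⇔≤-∨ : (ψ φ : KCon Sg A) → ψ ≤ forget (lift φ) ⇔ ψ ≤ θ ∨ φ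
    ≤-forget-lift⇔≤-∨ ψ φ = mk⇔
      (λ ψ≤ {_} {_} r → lift⇒∨ φ (ψ≤ r))
      (λ ψ≤ {_} {_} r → ∨⇒lift φ (ψ≤ r))

  private
    module ⇔-Reasoning = SetoidReasoning (⇔-setoid ℓ)

    ⇔⇒× : {P Q : Set ℓ} → P ⇔ Q → (P → Q) × (Q → P)
    ⇔⇒× e = Equivalence.to e , Equivalence.from e

    ×⇒⇔ : {P Q : Set ℓ} → (P → Q) × (Q → P) → P ⇔ Q
    ×⇒⇔ (to , from) = mk⇔ to from

  leftAdjoints⇒duallyBrouwerian :
    (∀ θ → HasLeftAdjoint _≤_ (Quotient._≤/_ θ) (Quotient.lift θ)) →
    DuallyBrouwerian _≤_ _∨_
  leftAdjoints⇒duallyBrouwerian adjoint a b = g (lift a) , λ c → ⇔⇒× (a-b≤c⇔ c)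
    where
    open Quotient b
    open ⇔-Reasoning
    g : KCon Sg A/θ → KCon Sg A
    g = proj₁ (adjoint b)
    a-b≤c⇔ : ∀ c → g (lift a) ≤ c ⇔ a ≤ b ∨ c
    a-b≤c⇔ c = begin
      g (lift a) ≤ c       ≈⟨ ×⇒⇔ (proj₂ (adjoint b) c (lift a)) ⟩
      lift a ≤/ lift c     ≈⟨ lift⊣forget a (lift c) ⟩
      a ≤ forget (lift c)  ≈⟨ ≤-forget-lift⇔≤-∨ a c ⟩
      a ≤ b ∨ c            ∎

  duallyBrouwerian⇒leftAdjoints :
    DuallyBrouwerian _≤_ _∨_ →
    ∀ θ → HasLeftAdjoint _≤_ (Quotient._≤/_ θ) (Quotient.lift θ)
  duallyBrouwerian⇒leftAdjoints minus θ = _−θ , λ a β → ⇔⇒× (β-θ≤a⇔ a β)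
    where
    open Quotient θ
    open ⇔-Reasoning
    _−θ : KCon Sg A/θ → KCon Sg A
    β −θ = proj₁ (minus (forget β) θ)
    β-θ≤a⇔ : ∀ a β → β −θ ≤ a ⇔ β ≤/ lift a
    β-θ≤a⇔ a β = begin
      β −θ ≤ a               ≈⟨ ×⇒⇔ (proj₂ (minus (forget β) θ) a) ⟩
      forget β ≤ θ ∨ a       ≈⟨ ≤-forget-lift⇔≤-∨ (forget β) a ⟨
      β ≤/ lift a            ∎

lemma4p6 : ∀ {ℓ : Level} {Sg : Signature ℓ} (A : Algebra Sg) →
    ((∀ (θ : KCon Sg A) →
        HasLeftAdjoint (_⊑_ Sg A) (_⊑_ Sg (_/_ Sg A θ))
          (compactLifting Sg (quotientMap Sg A θ)))
      → DuallyBrouwerian (_⊑_ Sg A) (_⊔K_ Sg A))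
    × (DuallyBrouwerian (_⊑_ Sg A) (_⊔K_ Sg A)
      → ∀ (θ : KCon Sg A) →
        HasLeftAdjoint (_⊑_ Sg A) (_⊑_ Sg (_/_ Sg A θ))
          (compactLifting Sg (quotientMap Sg A θ)))
lemma4p6 A = leftAdjoints⇒duallyBrouwerian A , duallyBrouwerian⇒leftAdjoints A
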